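{- Let $n,k$ be natural numbers with $k<n-k$, let $X=\{1,\ldots,n\}$, and let $L_{k,n}=(V,E)$ be the graph with $V=[X]^{k}\cup[X]^{n-k}$ and $E=\{AB : A\in[X]^{k},\ B\in[X]^{n-k},\ A\subseteq B\}$. For $A,B\in V$ with $i=|A\cap B|$ define $$d(A,B)=\begin{cases} 2\left\lceil \frac{k-i}{n-2k}\right\rceil+1, & \text{if } |A|\neq|B|,\\ 2\left\lceil \frac{|A|-i}{n-2k}\right\rceil, & \text{if } |A|=|B|.\end{cases}$$ Then $d(A,B)=\|AB\|$ for all $A,B\in V$, where $\|AB\|$ is the graph distance (length of a shortest path) between $A$ and $B$ in $L_{k,n}$.
   Context: $[X]^m$ denotes the set of all $m$-element subsets of $X$. -}

module Defs where

open import Data.Nat using (_≟_; ℕ; zero; suc; _+_; _*_; _∸_; _≤_; _<_)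
open import Data.Nat.DivMod using (_/_)
open import Data.Fin.Subset using (Subset; _⊆_; _∩_; ∣_∣)
open import Data.Product using (_×_)
open import Data.Sum using (_⊎_)
open import Relation.Binary.PropositionalEquality using (_≡_)
open import Relation.Nullary using (yes; no)

-- Ceiling division ⌈ a / b ⌉; the value for b = 0 is junk and never used
-- (the theorem assumes k < n - k, so n - 2k ≥ 1).
ceilDiv : ℕ → ℕ → ℕ
ceilDiv a zero    = zero
ceilDiv a (suc b) = (a + b) / suc b

Vertex : (n k : ℕ) → Subset n → Set
Vertex n k A = ∣ A ∣ ≡ k ⊎ ∣ A ∣ ≡ n ∸ k

Adj : (n k : ℕ) → Subset n → Subset n → Set
Adj n k A B =
  (∣ A ∣ ≡ k × ∣ B ∣ ≡ n ∸ k × A ⊆ B) ⊎ (∣ B ∣ ≡ k × ∣ A ∣ ≡ n ∸ k × B ⊆ A)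

data Walk (n k : ℕ) : Subset n → Subset n → ℕ → Set where
  here : ∀ {A} → Walk n k A A zero
  step : ∀ {A B C m} → Adj n k A B → Walk n k B C m → Walk n k A C (suc m)

IsDist : (n k : ℕ) → Subset n → Subset n → ℕ → Set
IsDist n k A B m = Walk n k A B m × (∀ m′ → Walk n k A B m′ → m ≤ m′)

dist-formula : (n k : ℕ) → Subset n → Subset n → ℕ
dist-formula n k A B with ∣ A ∣ ≟ ∣ B ∣
... | yes _ = 2 * ceilDiv (∣ A ∣ ∸ ∣ A ∩ B ∣) (n ∸ 2 * k)
... | no  _ = suc (2 * ceilDiv (k ∸ ∣ A ∩ B ∣) (n ∸ 2 * k))

-- The formula vanishes exactly on the diagonal and changes by at most one along every
-- edge, so it is a lower bound for the length of every walk. Conversely, from any vertex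
-- at positive formula value there is a neighbour where the value is one smaller: crossing
-- between the two layers adds or removes n - 2k elements, and choosing which ones moves
-- |A ∩ B| by up to n - 2k in the right direction. Descending step by step yields a walk
-- whose length is the formula.

module Submission where

open import Defs
open import Data.Nat using (ℕ; zero; suc; _+_; _*_; _∸_; _≤_; _<_; z≤n; s≤s; z<s; _≟_; _<?_)
open import Data.Nat.Properties
open import Data.Nat.DivMod using (_/_; /-monoˡ-≤; m<n⇒m/n≡0; n/n≡1; m/n≡1+[m∸n]/n)
open import Data.Fin.Subset using (Subset; _⊆_; _∩_; ∁; ∣_∣; ⊤; ⊥; inside; outside)
open import Data.Fin.Subset.Properties
  using (drop-∷-⊆; out⊆; s⊆s; ⊆-refl; ⊆-antisym; ⊥⊆; ⊆⊤; p⊆q⇒∣p∣≤∣q∣; x∈p∩q⁺; x∈p∩q⁻;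
         ∣p∩q∣≤∣p∣; ∣p∩q∣≤∣q∣; ∩-comm; ∩-idem; ∩-identityˡ; ∩-zeroˡ; ∣⊥∣≡0; ∣∁p∣≡n∸∣p∣)
open import Data.Vec using (_∷_; []; here; there)
open import Data.Product using (∃-syntax; _×_; _,_; proj₁; proj₂)
open import Data.Sum using (_⊎_; inj₁; inj₂)
open import Relation.Binary.PropositionalEquality
open import Relation.Nullary using (Dec; yes; no; contradiction)

private
  variable
    m : ℕ
    p q r : Subset m
    a c : ℕ

⊆-∷-inside : ∀ {x} → p ⊆ q → x ∷ p ⊆ inside ∷ q
⊆-∷-inside p⊆q here        = here
⊆-∷-inside p⊆q (there x∈p) = there (p⊆q x∈p)

p⊆q⇒∣p∩r∣≤∣q∩r∣ : ∀ (r : Subset m) → p ⊆ q → ∣ p ∩ r ∣ ≤ ∣ q ∩ r ∣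
p⊆q⇒∣p∩r∣≤∣q∩r∣ {p = p} r p⊆q = p⊆q⇒∣p∣≤∣q∣ λ x∈p∩r →
  let x∈p , x∈r = x∈p∩q⁻ p r x∈p∩r in x∈p∩q⁺ (p⊆q x∈p , x∈r)

∣p∣≡∣p∩q∣+∣p∩∁q∣ : ∀ (p q : Subset m) → ∣ p ∣ ≡ ∣ p ∩ q ∣ + ∣ p ∩ ∁ q ∣
∣p∣≡∣p∩q∣+∣p∩∁q∣ []            []            = refl
∣p∣≡∣p∩q∣+∣p∩∁q∣ (outside ∷ p) (_ ∷ q)       = ∣p∣≡∣p∩q∣+∣p∩∁q∣ p q
∣p∣≡∣p∩q∣+∣p∩∁q∣ (inside ∷ p)  (inside ∷ q)  = cong suc (∣p∣≡∣p∩q∣+∣p∩∁q∣ p q)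
∣p∣≡∣p∩q∣+∣p∩∁q∣ (inside ∷ p)  (outside ∷ q) =
  trans (cong suc (∣p∣≡∣p∩q∣+∣p∩∁q∣ p q)) (sym (+-suc _ _))

∣p∩∁q∣≡∣p∣∸∣p∩q∣ : ∀ (p q : Subset m) → ∣ p ∩ ∁ q ∣ ≡ ∣ p ∣ ∸ ∣ p ∩ q ∣
∣p∩∁q∣≡∣p∣∸∣p∩q∣ p q = sym (trans (cong (_∸ ∣ p ∩ q ∣) (∣p∣≡∣p∩q∣+∣p∩∁q∣ p q))
                                (m+n∸m≡n ∣ p ∩ q ∣ ∣ p ∩ ∁ q ∣))

∣p∩q∣≡∣p∣⇒p⊆q : ∀ (p q : Subset m) → ∣ p ∩ q ∣ ≡ ∣ p ∣ → p ⊆ q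
∣p∩q∣≡∣p∣⇒p⊆q []            []            _ = ⊆-refl
∣p∩q∣≡∣p∣⇒p⊆q (outside ∷ p) (_ ∷ q)       e = out⊆ (∣p∩q∣≡∣p∣⇒p⊆q p q e)
∣p∩q∣≡∣p∣⇒p⊆q (inside ∷ p)  (inside ∷ q)  e = s⊆s (∣p∩q∣≡∣p∣⇒p⊆q p q (suc-injective e))
∣p∩q∣≡∣p∣⇒p⊆q (inside ∷ p)  (outside ∷ q) e =
  contradiction (subst (_≤ ∣ p ∣) e (∣p∩q∣≤∣p∣ p q)) 1+n≰n

∣p∩q∣≡∣p∣≡∣q∣⇒p≡q : ∀ (p q : Subset m) → ∣ p ∩ q ∣ ≡ ∣ p ∣ → ∣ p ∣ ≡ ∣ q ∣ → p ≡ q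
∣p∩q∣≡∣p∣≡∣q∣⇒p≡q p q e₁ e₂ = ⊆-antisym (∣p∩q∣≡∣p∣⇒p⊆q p q e₁)
  (∣p∩q∣≡∣p∣⇒p⊆q q p (trans (cong ∣_∣ (∩-comm q p)) (trans e₁ e₂)))

Between : (p q r : Subset m) (a c : ℕ) → Set
Between p q r a c = ∃[ s ] p ⊆ s × s ⊆ q × ∣ s ∩ r ∣ ≡ a × ∣ s ∩ ∁ r ∣ ≡ c

exclude : ∀ {x y} → Between p q r a c → Between (outside ∷ p) (x ∷ q) (y ∷ r) a c
exclude (s , p⊆s , s⊆q , e₁ , e₂) = outside ∷ s , out⊆ p⊆s , out⊆ s⊆q , e₁ , e₂

include-∩ : ∀ {x} → Between p q r a c → Between (x ∷ p) (inside ∷ q) (inside ∷ r) (suc a) c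
include-∩ (s , p⊆s , s⊆q , e₁ , e₂) = inside ∷ s , ⊆-∷-inside p⊆s , s⊆s s⊆q , cong suc e₁ , e₂

include-∁ : ∀ {x} → Between p q r a c → Between (x ∷ p) (inside ∷ q) (outside ∷ r) a (suc c)
include-∁ (s , p⊆s , s⊆q , e₁ , e₂) = inside ∷ s , ⊆-∷-inside p⊆s , s⊆s s⊆q , e₁ , cong suc e₂

interpolate : ∀ (r : Subset m) → p ⊆ q →
              ∣ p ∩ r ∣ ≤ a → a ≤ ∣ q ∩ r ∣ → ∣ p ∩ ∁ r ∣ ≤ c → c ≤ ∣ q ∩ ∁ r ∣ →
              Between p q r a c
interpolate {p = []} {q = []} [] _ _ z≤n _ z≤n = [] , ⊆-refl , ⊆-refl , refl , refl
interpolate {p = inside ∷ p} {q = outside ∷ q} _ p⊆q _ _ _ _ = contradiction (p⊆q here) λ ()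
interpolate {p = inside ∷ p} {q = inside ∷ q} (inside ∷ r) p⊆q (s≤s l) (s≤s u) l′ u′ =
  include-∩ (interpolate r (drop-∷-⊆ p⊆q) l u l′ u′)
interpolate {p = inside ∷ p} {q = inside ∷ q} (outside ∷ r) p⊆q l u (s≤s l′) (s≤s u′) =
  include-∁ (interpolate r (drop-∷-⊆ p⊆q) l u l′ u′)
interpolate {p = outside ∷ p} {q = outside ∷ q} (_ ∷ r) p⊆q l u l′ u′ =
  exclude (interpolate r (drop-∷-⊆ p⊆q) l u l′ u′)
interpolate {p = outside ∷ p} {q = inside ∷ q} {a = a} (inside ∷ r) p⊆q l u l′ u′
  with ∣ p ∩ r ∣ <? a
... | yes (s≤s l″) = include-∩ (interpolate r (drop-∷-⊆ p⊆q) l″ (≤-pred u) l′ u′)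
... | no ≮ = exclude (interpolate r (drop-∷-⊆ p⊆q) l
                        (≤-trans (≮⇒≥ ≮) (p⊆q⇒∣p∩r∣≤∣q∩r∣ r (drop-∷-⊆ p⊆q))) l′ u′)
interpolate {p = outside ∷ p} {q = inside ∷ q} {c = c} (outside ∷ r) p⊆q l u l′ u′
  with ∣ p ∩ ∁ r ∣ <? c
... | yes (s≤s l″) = include-∁ (interpolate r (drop-∷-⊆ p⊆q) l u l″ (≤-pred u′))
... | no ≮ = exclude (interpolate r (drop-∷-⊆ p⊆q) l u l′
                        (≤-trans (≮⇒≥ ≮) (p⊆q⇒∣p∩r∣≤∣q∩r∣ (∁ r) (drop-∷-⊆ p⊆q))))

private
  ∣s∣≡a+c : ∀ (s r : Subset m) → ∣ s ∩ r ∣ ≡ a → ∣ s ∩ ∁ r ∣ ≡ c → ∣ s ∣ ≡ a + c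
  ∣s∣≡a+c s r e₁ e₂ = trans (∣p∣≡∣p∩q∣+∣p∩∁q∣ s r) (cong₂ _+_ e₁ e₂)

extend : ∀ (r : Subset m) → ∣ p ∩ r ∣ ≤ a → a ≤ ∣ r ∣ → ∣ p ∩ ∁ r ∣ ≤ c → c ≤ m ∸ ∣ r ∣ →
         ∃[ s ] p ⊆ s × ∣ s ∩ r ∣ ≡ a × ∣ s ∣ ≡ a + c
extend {m = m} {a = a} {c = c} r l u l′ u′
  with interpolate r ⊆⊤ l (subst (a ≤_) ∣⊤∩r∣ u) l′ (subst (c ≤_) ∣⊤∩∁r∣ u′)
  where
  ∣⊤∩r∣ : ∣ r ∣ ≡ ∣ ⊤ ∩ r ∣
  ∣⊤∩r∣ = cong ∣_∣ (sym (∩-identityˡ r))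
  ∣⊤∩∁r∣ : m ∸ ∣ r ∣ ≡ ∣ ⊤ ∩ ∁ r ∣
  ∣⊤∩∁r∣ = trans (sym (∣∁p∣≡n∸∣p∣ r)) (cong ∣_∣ (sym (∩-identityˡ (∁ r))))
... | s , p⊆s , _ , e₁ , e₂ = s , p⊆s , e₁ , ∣s∣≡a+c s r e₁ e₂

restrict : ∀ (r : Subset m) → a ≤ ∣ q ∩ r ∣ → c ≤ ∣ q ∩ ∁ r ∣ →
           ∃[ s ] s ⊆ q × ∣ s ∩ r ∣ ≡ a × ∣ s ∣ ≡ a + c
restrict {m = m} {a = a} {c = c} r u u′
  with interpolate r ⊥⊆ (subst (_≤ a) (∣⊥∩p∣≡0 r) z≤n) u (subst (_≤ c) (∣⊥∩p∣≡0 (∁ r)) z≤n) u′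
  where
  ∣⊥∩p∣≡0 : ∀ (p : Subset m) → 0 ≡ ∣ ⊥ ∩ p ∣
  ∣⊥∩p∣≡0 p = trans (sym (∣⊥∣≡0 m)) (cong ∣_∣ (sym (∩-zeroˡ p)))
... | s , _ , s⊆q , e₁ , e₂ = s , s⊆q , e₁ , ∣s∣≡a+c s r e₁ e₂

module _ {b : ℕ} where

  ceilDiv-zero : ceilDiv 0 (suc b) ≡ 0
  ceilDiv-zero = m<n⇒m/n≡0 (n<1+n b)

  ceilDiv-monoˡ-≤ : ∀ {x y} → x ≤ y → ceilDiv x (suc b) ≤ ceilDiv y (suc b)
  ceilDiv-monoˡ-≤ x≤y = /-monoˡ-≤ (suc b) (+-monoˡ-≤ b x≤y)

  ceilDiv-positive : ∀ {x} → 0 < x → 0 < ceilDiv x (suc b)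
  ceilDiv-positive {x} 0<x = subst (_≤ ceilDiv x (suc b)) (n/n≡1 (suc b)) (ceilDiv-monoˡ-≤ 0<x)

  ceilDiv-+ : ∀ x → ceilDiv (suc b + x) (suc b) ≡ suc (ceilDiv x (suc b))
  ceilDiv-+ x = begin
    (suc b + x + b) / suc b                 ≡⟨ cong (_/ suc b) (+-assoc (suc b) x b) ⟩
    (suc b + (x + b)) / suc b               ≡⟨ m/n≡1+[m∸n]/n (m≤m+n (suc b) (x + b)) ⟩
    suc ((suc b + (x + b) ∸ suc b) / suc b)
      ≡⟨ cong (λ y → suc (y / suc b)) (m+n∸m≡n (suc b) (x + b)) ⟩
    suc ((x + b) / suc b)                   ∎
    where open ≡-Reasoning

  ceilDiv-∸ : ∀ {x} → 0 < x → ceilDiv x (suc b) ≡ suc (ceilDiv (x ∸ suc b) (suc b))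
  ceilDiv-∸ {x} 0<x with ≤-total (suc b) x
  ... | inj₁ 1+b≤x =
    trans (cong (λ y → ceilDiv y (suc b)) (sym (m+[n∸m]≡n 1+b≤x))) (ceilDiv-+ (x ∸ suc b))
  ... | inj₂ x≤1+b = begin
    ceilDiv x (suc b)                 ≡⟨ ≤-antisym ceilDiv≤1 (ceilDiv-positive 0<x) ⟩
    1                                 ≡⟨ cong suc (sym ceilDiv-zero) ⟩
    suc (ceilDiv 0 (suc b))           ≡⟨ cong (λ y → suc (ceilDiv y (suc b))) 0≡x∸[1+b] ⟩
    suc (ceilDiv (x ∸ suc b) (suc b)) ∎
    where
    open ≡-Reasoning
    0≡x∸[1+b] : 0 ≡ x ∸ suc b
    0≡x∸[1+b] = sym (m≤n⇒m∸n≡0 x≤1+b)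
    ceilDiv≤1 : ceilDiv x (suc b) ≤ 1
    ceilDiv≤1 = ≤-trans (ceilDiv-monoˡ-≤ (≤-trans x≤1+b (m≤m+n (suc b) 0)))
                        (≤-reflexive (trans (ceilDiv-+ 0) (cong suc ceilDiv-zero)))

  2*ceilDiv-monoˡ-≤ : ∀ {x y} → x ≤ y → 2 * ceilDiv x (suc b) ≤ 2 * ceilDiv y (suc b)
  2*ceilDiv-monoˡ-≤ x≤y = *-monoʳ-≤ 2 (ceilDiv-monoˡ-≤ x≤y)

  2*ceilDiv-+ : ∀ {x y} → x ≤ suc b + y → 2 * ceilDiv x (suc b) ≤ 2 + 2 * ceilDiv y (suc b)
  2*ceilDiv-+ {y = y} x≤m+y =
    ≤-trans (*-monoʳ-≤ 2 (≤-trans (ceilDiv-monoˡ-≤ x≤m+y) (≤-reflexive (ceilDiv-+ y))))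
            (≤-reflexive (*-suc 2 (ceilDiv y (suc b))))

  2*ceilDiv≡1+⇒ : ∀ x {d} → 2 * ceilDiv x (suc b) ≡ suc d →
                  d ≡ suc (2 * ceilDiv (x ∸ suc b) (suc b))
  2*ceilDiv≡1+⇒ zero    e = contradiction (trans (cong (2 *_) (sym ceilDiv-zero)) e) λ ()
  2*ceilDiv≡1+⇒ (suc x) e =
    suc-injective (trans (sym e) (trans (cong (2 *_) (ceilDiv-∸ z<s)) (*-suc 2 _)))

  2*ceilDiv≡0⇒≡0 : ∀ x → 2 * ceilDiv x (suc b) ≡ 0 → x ≡ 0
  2*ceilDiv≡0⇒≡0 zero    _ = refl
  2*ceilDiv≡0⇒≡0 (suc x) e with ceilDiv (suc x) (suc b) | ceilDiv-positive {suc x} z<s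
  ... | suc _ | _ = contradiction e λ ()

m+n∸o≤m+[n∸o] : ∀ m n o → m + n ∸ o ≤ m + (n ∸ o)
m+n∸o≤m+[n∸o] m n o = m≤n+o⇒m∸n≤o (m + n) o (begin
  m + n             ≤⟨ +-monoʳ-≤ m (m≤n+m∸n n o) ⟩
  m + (o + (n ∸ o)) ≡⟨ sym (+-assoc m o (n ∸ o)) ⟩
  m + o + (n ∸ o)   ≡⟨ cong (_+ (n ∸ o)) (+-comm m o) ⟩
  o + m + (n ∸ o)   ≡⟨ +-assoc o m (n ∸ o) ⟩
  o + (m + (n ∸ o)) ∎)
  where open ≤-Reasoning

m∸[m∸n]≤n : ∀ m n → m ∸ (m ∸ n) ≤ n
m∸[m∸n]≤n m n = m≤n+o⇒m∸n≤o m (m ∸ n) (subst (m ≤_) (+-comm n (m ∸ n)) (m≤n+m∸n m n))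

-- The graph L_{k,n}, with n = k + (M + k) and M = n - 2k > 0

module Distance (k b : ℕ) where

  private
    M : ℕ
    M = suc b

    n : ℕ
    n = k + (M + k)

    ⌈_⌉ : ℕ → ℕ
    ⌈ x ⌉ = ceilDiv x M

    dist : Subset n → Subset n → ℕ
    dist = dist-formula n k

    variable
      A B S T : Subset n
      d : ℕ

  n∸k≡M+k : n ∸ k ≡ M + k
  n∸k≡M+k = m+n∸m≡n k (M + k)

  n∸2k≡M : n ∸ 2 * k ≡ M
  n∸2k≡M = begin
    k + (M + k) ∸ (k + (k + 0)) ≡⟨ [m+n]∸[m+o]≡n∸o k (M + k) (k + 0) ⟩
    M + k ∸ (k + 0)             ≡⟨ cong (M + k ∸_) (+-identityʳ k) ⟩
    M + k ∸ k                   ≡⟨ m+n∸n≡m M k ⟩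
    M                           ∎
    where open ≡-Reasoning

  Vertex′ : Subset n → Set
  Vertex′ A = ∣ A ∣ ≡ k ⊎ ∣ A ∣ ≡ M + k

  toVertex′ : ∀ A → Vertex n k A → Vertex′ A
  toVertex′ _ (inj₁ ∣A∣≡k)   = inj₁ ∣A∣≡k
  toVertex′ _ (inj₂ ∣A∣≡n∸k) = inj₂ (trans ∣A∣≡n∸k n∸k≡M+k)

  formula-≡ : ∀ A B → ∣ A ∣ ≡ ∣ B ∣ → dist A B ≡ 2 * ⌈ ∣ A ∣ ∸ ∣ A ∩ B ∣ ⌉
  formula-≡ A B ∣A∣≡∣B∣ with ∣ A ∣ ≟ ∣ B ∣
  ... | yes _ = cong (λ m → 2 * ceilDiv (∣ A ∣ ∸ ∣ A ∩ B ∣) m) n∸2k≡M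
  ... | no ∣A∣≢∣B∣ = contradiction ∣A∣≡∣B∣ ∣A∣≢∣B∣

  formula-≢ : ∀ A B → ∣ A ∣ ≢ ∣ B ∣ → dist A B ≡ suc (2 * ⌈ k ∸ ∣ A ∩ B ∣ ⌉)
  formula-≢ A B ∣A∣≢∣B∣ with ∣ A ∣ ≟ ∣ B ∣
  ... | yes ∣A∣≡∣B∣ = contradiction ∣A∣≡∣B∣ ∣A∣≢∣B∣
  ... | no _ = cong (λ m → suc (2 * ceilDiv (k ∸ ∣ A ∩ B ∣) m)) n∸2k≡M

  -- In the names below, k and K stand for the layers [X]^k and [X]^(n-k) containing
  -- the two vertices, in argument order.
  formula-kk : ∀ A B → ∣ A ∣ ≡ k → ∣ B ∣ ≡ k → dist A B ≡ 2 * ⌈ k ∸ ∣ A ∩ B ∣ ⌉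
  formula-kk A B ∣A∣≡k ∣B∣≡k =
    trans (formula-≡ A B (trans ∣A∣≡k (sym ∣B∣≡k))) (cong (λ a → 2 * ⌈ a ∸ ∣ A ∩ B ∣ ⌉) ∣A∣≡k)

  formula-KK : ∀ A B → ∣ A ∣ ≡ M + k → ∣ B ∣ ≡ M + k → dist A B ≡ 2 * ⌈ M + k ∸ ∣ A ∩ B ∣ ⌉
  formula-KK A B ∣A∣≡M+k ∣B∣≡M+k =
    trans (formula-≡ A B (trans ∣A∣≡M+k (sym ∣B∣≡M+k))) (cong (λ a → 2 * ⌈ a ∸ ∣ A ∩ B ∣ ⌉) ∣A∣≡M+k)

  formula-kK : ∀ A B → ∣ A ∣ ≡ k → ∣ B ∣ ≡ M + k → dist A B ≡ suc (2 * ⌈ k ∸ ∣ A ∩ B ∣ ⌉)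
  formula-kK A B ∣A∣≡k ∣B∣≡M+k =
    formula-≢ A B λ e → m≢1+n+m k (trans (sym ∣A∣≡k) (trans e ∣B∣≡M+k))

  formula-Kk : ∀ A B → ∣ A ∣ ≡ M + k → ∣ B ∣ ≡ k → dist A B ≡ suc (2 * ⌈ k ∸ ∣ A ∩ B ∣ ⌉)
  formula-Kk A B ∣A∣≡M+k ∣B∣≡k =
    formula-≢ A B λ e → m≢1+n+m k (trans (sym ∣B∣≡k) (trans (sym e) ∣A∣≡M+k))

  formula-refl : ∀ A → dist A A ≡ 0
  formula-refl A = begin
    dist A A                   ≡⟨ formula-≡ A A refl ⟩
    2 * ⌈ ∣ A ∣ ∸ ∣ A ∩ A ∣ ⌉  ≡⟨ cong (λ a → 2 * ⌈ ∣ A ∣ ∸ ∣ a ∣ ⌉) (∩-idem A) ⟩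
    2 * ⌈ ∣ A ∣ ∸ ∣ A ∣ ⌉      ≡⟨ cong (λ a → 2 * ⌈ a ⌉) (n∸n≡0 ∣ A ∣) ⟩
    2 * ⌈ 0 ⌉                  ≡⟨ cong (2 *_) (ceilDiv-zero {b}) ⟩
    0                          ∎
    where open ≡-Reasoning

  formula≡0⇒≡ : dist A B ≡ 0 → A ≡ B
  formula≡0⇒≡ {A} {B} dist≡0 = by-sizes (∣ A ∣ ≟ ∣ B ∣)
    where
    by-sizes : Dec (∣ A ∣ ≡ ∣ B ∣) → A ≡ B
    by-sizes (no ∣A∣≢∣B∣)  = contradiction (trans (sym (formula-≢ A B ∣A∣≢∣B∣)) dist≡0) λ ()
    by-sizes (yes ∣A∣≡∣B∣) = ∣p∩q∣≡∣p∣≡∣q∣⇒p≡q A B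
      (≤-antisym (∣p∩q∣≤∣p∣ A B)
        (m∸n≡0⇒m≤n (2*ceilDiv≡0⇒≡0 _ (trans (sym (formula-≡ A B ∣A∣≡∣B∣)) dist≡0))))
      ∣A∣≡∣B∣

  module EdgeBounds (S⊆T : S ⊆ T) (∣S∣≡k : ∣ S ∣ ≡ k) (∣T∣≡M+k : ∣ T ∣ ≡ M + k) (B : Subset n)
    where

    s t : ℕ
    s = ∣ S ∩ B ∣
    t = ∣ T ∩ B ∣

    s≤t : s ≤ t
    s≤t = p⊆q⇒∣p∩r∣≤∣q∩r∣ B S⊆T

    t≤M+s : t ≤ M + s
    t≤M+s = +-cancelʳ-≤ ∣ S ∩ ∁ B ∣ t (M + s) (begin
      t + ∣ S ∩ ∁ B ∣              ≤⟨ +-monoʳ-≤ t (p⊆q⇒∣p∩r∣≤∣q∩r∣ (∁ B) S⊆T) ⟩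
      t + ∣ T ∩ ∁ B ∣              ≡⟨ sym (∣p∣≡∣p∩q∣+∣p∩∁q∣ T B) ⟩
      ∣ T ∣                        ≡⟨ ∣T∣≡M+k ⟩
      M + k                        ≡⟨ cong (M +_) (trans (sym ∣S∣≡k) (∣p∣≡∣p∩q∣+∣p∩∁q∣ S B)) ⟩
      M + (s + ∣ S ∩ ∁ B ∣)        ≡⟨ sym (+-assoc M s ∣ S ∩ ∁ B ∣) ⟩
      M + s + ∣ S ∩ ∁ B ∣          ∎)
      where open ≤-Reasoning

    k∸s≤M+k∸t : k ∸ s ≤ M + k ∸ t
    k∸s≤M+k∸t = subst (_≤ M + k ∸ t) ([m+n]∸[m+o]≡n∸o M k s) (∸-monoʳ-≤ (M + k) t≤M+s)

    k∸s≤M+[k∸t] : k ∸ s ≤ M + (k ∸ t)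
    k∸s≤M+[k∸t] = ≤-trans k∸s≤M+k∸t (m+n∸o≤m+[n∸o] M k t)

    M+k∸t≤M+[k∸s] : M + k ∸ t ≤ M + (k ∸ s)
    M+k∸t≤M+[k∸s] = ≤-trans (∸-monoʳ-≤ (M + k) s≤t) (m+n∸o≤m+[n∸o] M k s)

  formula-⊆ : S ⊆ T → ∣ S ∣ ≡ k → ∣ T ∣ ≡ M + k → Vertex′ B →
              dist S B ≤ suc (dist T B) × dist T B ≤ suc (dist S B)
  formula-⊆ {S} {T} {B} S⊆T ∣S∣≡k ∣T∣≡M+k (inj₁ ∣B∣≡k)
    rewrite formula-kk S B ∣S∣≡k ∣B∣≡k | formula-Kk T B ∣T∣≡M+k ∣B∣≡k =
    2*ceilDiv-+ k∸s≤M+[k∸t] , s≤s (2*ceilDiv-monoˡ-≤ (∸-monoʳ-≤ k s≤t))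
    where open EdgeBounds S⊆T ∣S∣≡k ∣T∣≡M+k B
  formula-⊆ {S} {T} {B} S⊆T ∣S∣≡k ∣T∣≡M+k (inj₂ ∣B∣≡M+k)
    rewrite formula-kK S B ∣S∣≡k ∣B∣≡M+k | formula-KK T B ∣T∣≡M+k ∣B∣≡M+k =
    s≤s (2*ceilDiv-monoˡ-≤ k∸s≤M+k∸t) , 2*ceilDiv-+ M+k∸t≤M+[k∸s]
    where open EdgeBounds S⊆T ∣S∣≡k ∣T∣≡M+k B

  formula-adj : Adj n k A T → Vertex′ B → dist A B ≤ suc (dist T B)
  formula-adj (inj₁ (∣A∣≡k , ∣T∣≡n∸k , A⊆T)) vB =
    proj₁ (formula-⊆ A⊆T ∣A∣≡k (trans ∣T∣≡n∸k n∸k≡M+k) vB)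
  formula-adj (inj₂ (∣T∣≡k , ∣A∣≡n∸k , T⊆A)) vB =
    proj₂ (formula-⊆ T⊆A ∣T∣≡k (trans ∣A∣≡n∸k n∸k≡M+k) vB)

  formula-≤-walk : ∀ {w} → Walk n k A B w → Vertex′ B → dist A B ≤ w
  formula-≤-walk {A} here            _  = ≤-reflexive (formula-refl A)
  formula-≤-walk     (step adj walk) vB =
    ≤-trans (formula-adj adj vB) (s≤s (formula-≤-walk walk vB))

  CloserNeighbour : Subset n → Subset n → ℕ → Set
  CloserNeighbour A B d = ∃[ A′ ] Adj n k A A′ × Vertex′ A′ × dist A′ B ≡ d

  grow : ∣ A ∣ ≡ k → A ⊆ T → ∣ T ∣ ≡ M + k → dist T B ≡ d → CloserNeighbour A B d
  grow {T = T} ∣A∣≡k A⊆T ∣T∣≡M+k e =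
    T , inj₁ (∣A∣≡k , trans ∣T∣≡M+k (sym n∸k≡M+k) , A⊆T) , inj₂ ∣T∣≡M+k , e

  shrink : ∣ A ∣ ≡ M + k → S ⊆ A → ∣ S ∣ ≡ k → dist S B ≡ d → CloserNeighbour A B d
  shrink {S = S} ∣A∣≡M+k S⊆A ∣S∣≡k e =
    S , inj₂ (∣S∣≡k , trans ∣A∣≡M+k (sym n∸k≡M+k) , S⊆A) , inj₁ ∣S∣≡k , e

  -- From a k-set, add M elements, as many of them from B as possible (kk) or all from B (kK);
  -- from an (n-k)-set, drop M elements, keeping as much of A ∩ B as fits (Kk, KK).
  descend-kk : ∣ A ∣ ≡ k → ∣ B ∣ ≡ k → dist A B ≡ suc d → CloserNeighbour A B d
  descend-kk {A} {B} {d} ∣A∣≡k ∣B∣≡k e =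
    let T , A⊆T , ∣T∩B∣≡k∸y , ∣T∣≡k∸y+[M+y] =
          extend {p = A} B i≤k∸y k∸y≤∣B∣ ∣A∩∁B∣≤M+y M+y≤n∸∣B∣
        ∣T∣≡M+k = trans ∣T∣≡k∸y+[M+y] size
    in grow ∣A∣≡k A⊆T ∣T∣≡M+k (begin
         dist T B                    ≡⟨ formula-Kk T B ∣T∣≡M+k ∣B∣≡k ⟩
         suc (2 * ⌈ k ∸ ∣ T ∩ B ∣ ⌉)  ≡⟨ cong (λ a → suc (2 * ⌈ k ∸ a ⌉)) ∣T∩B∣≡k∸y ⟩
         suc (2 * ⌈ k ∸ (k ∸ y) ⌉)    ≡⟨ cong (λ a → suc (2 * ⌈ a ⌉)) (m∸[m∸n]≡n y≤k) ⟩
         suc (2 * ⌈ y ⌉)              ≡⟨ sym d≡1+2⌈y⌉ ⟩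
         d                            ∎)
    where
    open ≡-Reasoning
    i = ∣ A ∩ B ∣
    y = k ∸ i ∸ M
    d≡1+2⌈y⌉ : d ≡ suc (2 * ⌈ y ⌉)
    d≡1+2⌈y⌉ = 2*ceilDiv≡1+⇒ (k ∸ i) (trans (sym (formula-kk A B ∣A∣≡k ∣B∣≡k)) e)
    y≤k∸i : y ≤ k ∸ i
    y≤k∸i = m∸n≤m (k ∸ i) M
    y≤k : y ≤ k
    y≤k = ≤-trans y≤k∸i (m∸n≤m k i)
    i≤k∸y : i ≤ k ∸ y
    i≤k∸y = subst (_≤ k ∸ y) (m∸[m∸n]≡n (≤-trans (∣p∩q∣≤∣p∣ A B) (≤-reflexive ∣A∣≡k)))
                  (∸-monoʳ-≤ k y≤k∸i)
    k∸y≤∣B∣ : k ∸ y ≤ ∣ B ∣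
    k∸y≤∣B∣ = ≤-trans (m∸n≤m k y) (≤-reflexive (sym ∣B∣≡k))
    ∣A∩∁B∣≤M+y : ∣ A ∩ ∁ B ∣ ≤ M + y
    ∣A∩∁B∣≤M+y = subst (_≤ M + y) (sym (trans (∣p∩∁q∣≡∣p∣∸∣p∩q∣ A B) (cong (_∸ i) ∣A∣≡k)))
                       (m≤n+m∸n (k ∸ i) M)
    M+y≤n∸∣B∣ : M + y ≤ n ∸ ∣ B ∣
    M+y≤n∸∣B∣ = subst (M + y ≤_) (sym (trans (cong (n ∸_) ∣B∣≡k) n∸k≡M+k)) (+-monoʳ-≤ M y≤k)
    size : k ∸ y + (M + y) ≡ M + k
    size = begin
      k ∸ y + (M + y) ≡⟨ cong (k ∸ y +_) (+-comm M y) ⟩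
      k ∸ y + (y + M) ≡⟨ sym (+-assoc (k ∸ y) y M) ⟩
      k ∸ y + y + M   ≡⟨ cong (_+ M) (m∸n+n≡m y≤k) ⟩
      k + M           ≡⟨ +-comm k M ⟩
      M + k           ∎

  descend-kK : ∣ A ∣ ≡ k → ∣ B ∣ ≡ M + k → dist A B ≡ suc d → CloserNeighbour A B d
  descend-kK {A} {B} {d} ∣A∣≡k ∣B∣≡M+k e =
    let T , A⊆T , ∣T∩B∣≡M+i , ∣T∣≡M+i+[k∸i] =
          extend {p = A} B (m≤n+m i M) M+i≤∣B∣ ∣A∩∁B∣≤k∸i k∸i≤n∸∣B∣
        ∣T∣≡M+k = trans ∣T∣≡M+i+[k∸i] (trans (+-assoc M i (k ∸ i)) (cong (M +_) (m+[n∸m]≡n i≤k)))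
    in grow ∣A∣≡k A⊆T ∣T∣≡M+k (begin
         dist T B                   ≡⟨ formula-KK T B ∣T∣≡M+k ∣B∣≡M+k ⟩
         2 * ⌈ M + k ∸ ∣ T ∩ B ∣ ⌉  ≡⟨ cong (λ a → 2 * ⌈ M + k ∸ a ⌉) ∣T∩B∣≡M+i ⟩
         2 * ⌈ M + k ∸ (M + i) ⌉    ≡⟨ cong (λ a → 2 * ⌈ a ⌉) ([m+n]∸[m+o]≡n∸o M k i) ⟩
         2 * ⌈ k ∸ i ⌉              ≡⟨ suc-injective (trans (sym (formula-kK A B ∣A∣≡k ∣B∣≡M+k)) e) ⟩
         d                          ∎)
    where
    open ≡-Reasoning
    i = ∣ A ∩ B ∣
    i≤k : i ≤ k
    i≤k = ≤-trans (∣p∩q∣≤∣p∣ A B) (≤-reflexive ∣A∣≡k)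
    M+i≤∣B∣ : M + i ≤ ∣ B ∣
    M+i≤∣B∣ = subst (M + i ≤_) (sym ∣B∣≡M+k) (+-monoʳ-≤ M i≤k)
    ∣A∩∁B∣≤k∸i : ∣ A ∩ ∁ B ∣ ≤ k ∸ i
    ∣A∩∁B∣≤k∸i = ≤-reflexive (trans (∣p∩∁q∣≡∣p∣∸∣p∩q∣ A B) (cong (_∸ i) ∣A∣≡k))
    k∸i≤n∸∣B∣ : k ∸ i ≤ n ∸ ∣ B ∣
    k∸i≤n∸∣B∣ = subst (k ∸ i ≤_) (sym (trans (cong (n ∸_) ∣B∣≡M+k) (m+n∸n≡m k (M + k)))) (m∸n≤m k i)

  k∸∣A∩B∣≤∣A∩∁B∣ : ∀ (A B : Subset n) → ∣ A ∣ ≡ M + k → k ∸ ∣ A ∩ B ∣ ≤ ∣ A ∩ ∁ B ∣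
  k∸∣A∩B∣≤∣A∩∁B∣ A B ∣A∣≡M+k =
    subst (k ∸ ∣ A ∩ B ∣ ≤_) (sym (trans (∣p∩∁q∣≡∣p∣∸∣p∩q∣ A B) (cong (_∸ ∣ A ∩ B ∣) ∣A∣≡M+k)))
          (∸-monoˡ-≤ ∣ A ∩ B ∣ (m≤n+m k M))

  descend-Kk : ∣ A ∣ ≡ M + k → ∣ B ∣ ≡ k → dist A B ≡ suc d → CloserNeighbour A B d
  descend-Kk {A} {B} {d} ∣A∣≡M+k ∣B∣≡k e =
    let S , S⊆A , ∣S∩B∣≡i , ∣S∣≡i+[k∸i] =
          restrict {q = A} B ≤-refl (k∸∣A∩B∣≤∣A∩∁B∣ A B ∣A∣≡M+k)
        ∣S∣≡k = trans ∣S∣≡i+[k∸i] (m+[n∸m]≡n i≤k)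
    in shrink ∣A∣≡M+k S⊆A ∣S∣≡k (begin
         dist S B               ≡⟨ formula-kk S B ∣S∣≡k ∣B∣≡k ⟩
         2 * ⌈ k ∸ ∣ S ∩ B ∣ ⌉  ≡⟨ cong (λ a → 2 * ⌈ k ∸ a ⌉) ∣S∩B∣≡i ⟩
         2 * ⌈ k ∸ i ⌉          ≡⟨ suc-injective (trans (sym (formula-Kk A B ∣A∣≡M+k ∣B∣≡k)) e) ⟩
         d                      ∎)
    where
    open ≡-Reasoning
    i = ∣ A ∩ B ∣
    i≤k : i ≤ k
    i≤k = ≤-trans (∣p∩q∣≤∣q∣ A B) (≤-reflexive ∣B∣≡k)

  descend-KK : ∣ A ∣ ≡ M + k → ∣ B ∣ ≡ M + k → dist A B ≡ suc d → CloserNeighbour A B d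
  descend-KK {A} {B} {d} ∣A∣≡M+k ∣B∣≡M+k e =
    let S , S⊆A , ∣S∩B∣≡k∸[k∸i] , ∣S∣≡k∸[k∸i]+[k∸i] =
          restrict {q = A} B (m∸[m∸n]≤n k i) (k∸∣A∩B∣≤∣A∩∁B∣ A B ∣A∣≡M+k)
        ∣S∣≡k = trans ∣S∣≡k∸[k∸i]+[k∸i] (m∸n+n≡m (m∸n≤m k i))
    in shrink ∣A∣≡M+k S⊆A ∣S∣≡k (begin
         dist S B                      ≡⟨ formula-kK S B ∣S∣≡k ∣B∣≡M+k ⟩
         suc (2 * ⌈ k ∸ ∣ S ∩ B ∣ ⌉)   ≡⟨ cong (λ a → suc (2 * ⌈ k ∸ a ⌉)) ∣S∩B∣≡k∸[k∸i] ⟩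
         suc (2 * ⌈ k ∸ (k ∸ (k ∸ i)) ⌉) ≡⟨ cong (λ a → suc (2 * ⌈ a ⌉)) (m∸[m∸n]≡n (m∸n≤m k i)) ⟩
         suc (2 * ⌈ k ∸ i ⌉)           ≡⟨ sym d≡1+2⌈k∸i⌉ ⟩
         d                             ∎)
    where
    open ≡-Reasoning
    i = ∣ A ∩ B ∣
    M+k∸i∸M≡k∸i : M + k ∸ i ∸ M ≡ k ∸ i
    M+k∸i∸M≡k∸i = trans (∸-+-assoc (M + k) i M)
                        (trans (cong (M + k ∸_) (+-comm i M)) ([m+n]∸[m+o]≡n∸o M k i))
    d≡1+2⌈k∸i⌉ : d ≡ suc (2 * ⌈ k ∸ i ⌉)
    d≡1+2⌈k∸i⌉ = trans (2*ceilDiv≡1+⇒ (M + k ∸ i) (trans (sym (formula-KK A B ∣A∣≡M+k ∣B∣≡M+k)) e))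
                       (cong (λ a → suc (2 * ⌈ a ⌉)) M+k∸i∸M≡k∸i)

  descend : Vertex′ A → Vertex′ B → dist A B ≡ suc d → CloserNeighbour A B d
  descend (inj₁ ∣A∣≡k)   (inj₁ ∣B∣≡k)   = descend-kk ∣A∣≡k ∣B∣≡k
  descend (inj₁ ∣A∣≡k)   (inj₂ ∣B∣≡M+k) = descend-kK ∣A∣≡k ∣B∣≡M+k
  descend (inj₂ ∣A∣≡M+k) (inj₁ ∣B∣≡k)   = descend-Kk ∣A∣≡M+k ∣B∣≡k
  descend (inj₂ ∣A∣≡M+k) (inj₂ ∣B∣≡M+k) = descend-KK ∣A∣≡M+k ∣B∣≡M+k

  walk-of-formula : ∀ d → Vertex′ A → Vertex′ B → dist A B ≡ d → Walk n k A B d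
  walk-of-formula {A} zero _ _ dist≡0 = subst (λ B → Walk n k A B 0) (formula≡0⇒≡ dist≡0) here
  walk-of-formula (suc d) vA vB dist≡1+d =
    let A′ , adj , vA′ , dist≡d = descend vA vB dist≡1+d
    in step adj (walk-of-formula d vA′ vB dist≡d)

  isDist : ∀ A B → Vertex n k A → Vertex n k B → IsDist n k A B (dist A B)
  isDist A B vA vB = walk-of-formula (dist A B) (toVertex′ A vA) (toVertex′ B vB) refl
                   , λ _ walk → formula-≤-walk walk (toVertex′ B vB)

n≡k+[1+b+k] : ∀ n k → k < n ∸ k → ∃[ b ] n ≡ k + (suc b + k)
n≡k+[1+b+k] n k k<n∸k = n ∸ k ∸ suc k , (begin
  n                             ≡⟨ sym (m+[n∸m]≡n k≤n) ⟩
  k + (n ∸ k)                   ≡⟨ cong (k +_) (sym (m∸n+n≡m k<n∸k)) ⟩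
  k + (n ∸ k ∸ suc k + suc k)   ≡⟨ cong (k +_) (+-suc (n ∸ k ∸ suc k) k) ⟩
  k + (suc (n ∸ k ∸ suc k) + k) ∎)
  where
  open ≡-Reasoning
  k≤n : k ≤ n
  k≤n = <⇒≤ (m∸n≢0⇒n<m λ n∸k≡0 → n≮0 (subst (k <_) n∸k≡0 k<n∸k))

mainTheorem4 : (n k : ℕ) → k < n ∸ k →
    (A B : Subset n) → Vertex n k A → Vertex n k B →
    IsDist n k A B (dist-formula n k A B)
mainTheorem4 n k k<n∸k with n≡k+[1+b+k] n k k<n∸k
... | b , refl = Distance.isDist k b
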